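{- Let $(G_1,G_2,S)$ be a constrained alignment instance with $m_2=1$. Let $K$ be a clique in the conflict graph $\mathcal{C}$, and let $x\in K$ be a $c_4$ written $abcd$. Let $S_1$ (resp. $S_2$) be the set of $c_4$s in $K$ that conflict with $x$ in a Type1a (resp. Type1b) configuration, and let $S_3$ be the set consisting of $x$ together with all $c_4$s in $K$ that conflict with $x$ in a Type2 or Type3 configuration. Then any two $c_4$s lying in different sets among $S_1,S_2,S_3$ do not share a similarity edge.
   Context: Let $G_1=(V_1,E_1)$ and $G_2=(V_2,E_2)$ be finite simple undirected graphs with $V_1\cap V_2=\emptyset$, and let $S$ be a bipartite graph with parts $V_1,V_2$ in which every vertex of $V_1$ has degree at most $m_1$ and every vertex of $V_2$ has degree at most $m_2$ ($m_1$ a positive integer); edges of $S$ are similarity edges. A $c_4$ is a 4-cycle $a-b-c-d-a$ in $G_1\cup G_2\cup S$ with $a,b\in V_1$, $c,d\in V_2$, $ab\in E_1$, $cd\in E_2$, $ad,bc\in E(S)$, written $abcd$ and regarded as a subgraph. Two distinct $c_4$s conflict if their similarity edges cannot all belong to a common matching of $S$. The conflict graph $\mathcal{C}$ has one vertex per $c_4$ and an edge between each pair of conflicting $c_4$s. With $m_2=1$, for $x=abcd$ and a $c_4$ $w$ conflicting with $x$: $w$ is in a Type1 configuration with $x$ if they share exactly one vertex of $V_1$; Type2 if they share both vertices of $V_1$ and no vertex of $V_2$; Type3 if they share both vertices of $V_1$ and exactly one vertex of $V_2$. A Type1 configuration is Type1a if the shared $V_1$-vertex is $a$ and Type1b if it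 is $b$. (Every $c_4$ conflicting with $x$ is of exactly one of these types.) -}

module Defs where

open import Data.Nat using (ℕ; _≤_)
open import Data.Bool using (Bool; true; false)
open import Data.Fin using (Fin)
open import Data.Fin.Subset using (∣_∣)
open import Data.Vec using (tabulate)
open import Data.Product using (Σ; _×_; _,_; proj₁; proj₂)
open import Data.Sum using (_⊎_)
open import Relation.Nullary using (¬_)
open import Relation.Binary.PropositionalEquality using (_≡_; _≢_)

-- V₁ = Fin n₁ and V₂ = Fin n₂ (disjoint by construction).
-- S is a bipartite graph between V₁ and V₂; degree of a ∈ V₁ is the number of
-- c ∈ V₂ with S a c ≡ true (cardinality of the subset tabulate (S a)).
record CAI : Set where
  field
    n₁ n₂ : ℕ
    E₁ : Fin n₁ → Fin n₁ → Bool
    E₂ : Fin n₂ → Fin n₂ → Bool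
    S  : Fin n₁ → Fin n₂ → Bool
    E₁-sym    : ∀ u v → E₁ u v ≡ E₁ v u
    E₁-irrefl : ∀ u → E₁ u u ≡ false
    E₂-sym    : ∀ u v → E₂ u v ≡ E₂ v u
    E₂-irrefl : ∀ u → E₂ u u ≡ false
    m₁ m₂ : ℕ
    m₁-pos : 1 ≤ m₁
    deg₁ : ∀ a → ∣ tabulate (S a) ∣ ≤ m₁
    deg₂ : ∀ c → ∣ tabulate (λ a → S a c) ∣ ≤ m₂

module _ (I : CAI) where
  open CAI I

  record C4 : Set where
    constructor c4
    field
      a b : Fin n₁
      c d : Fin n₂
      ab : E₁ a b ≡ true
      cd : E₂ c d ≡ true
      ad : S a d ≡ true
      bc : S b c ≡ true
  open C4 public

  -- c₄s are regarded as subgraphs: abcd and badc are the same subgraph.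
  SameC4 : C4 → C4 → Set
  SameC4 x y =
    (a y ≡ a x × b y ≡ b x × c y ≡ c x × d y ≡ d x)
    ⊎ (a y ≡ b x × b y ≡ a x × c y ≡ d x × d y ≡ c x)

  SimEdge : Set
  SimEdge = Fin n₁ × Fin n₂

  HasSimEdge : C4 → SimEdge → Set
  HasSimEdge x e = e ≡ (a x , d x) ⊎ e ≡ (b x , c x)

  IsMatching : (Fin n₁ → Fin n₂ → Bool) → Set
  IsMatching M =
    (∀ u v → M u v ≡ true → S u v ≡ true)
    × (∀ (e f : SimEdge) → M (proj₁ e) (proj₂ e) ≡ true → M (proj₁ f) (proj₂ f) ≡ true →
         e ≢ f → proj₁ e ≢ proj₁ f × proj₂ e ≢ proj₂ f)

  Conflict : C4 → C4 → Set
  Conflict x y =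
    ¬ SameC4 x y
    × ¬ (Σ (Fin n₁ → Fin n₂ → Bool) λ M → IsMatching M
           × (∀ e → HasSimEdge x e ⊎ HasSimEdge y e → M (proj₁ e) (proj₂ e) ≡ true))

  IsClique : (C4 → Set) → Set
  IsClique K = ∀ y z → K y → K z → ¬ SameC4 y z → Conflict y z

  InV₁ : Fin n₁ → C4 → Set
  InV₁ v w = v ≡ a w ⊎ v ≡ b w

  InV₂ : Fin n₂ → C4 → Set
  InV₂ v w = v ≡ c w ⊎ v ≡ d w

  Type1a : C4 → C4 → Set
  Type1a x w = InV₁ (a x) w × ¬ InV₁ (b x) w

  Type1b : C4 → C4 → Set
  Type1b x w = InV₁ (b x) w × ¬ InV₁ (a x) w

  Type2 : C4 → C4 → Set
  Type2 x w = InV₁ (a x) w × InV₁ (b x) w × ¬ InV₂ (c x) w × ¬ InV₂ (d x) w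

  Type3 : C4 → C4 → Set
  Type3 x w = InV₁ (a x) w × InV₁ (b x) w
    × ((InV₂ (c x) w × ¬ InV₂ (d x) w) ⊎ (¬ InV₂ (c x) w × InV₂ (d x) w))

  -- the sets S₁, S₂, S₃ (indexed by Fin 3: 0 ↦ S₁, 1 ↦ S₂, 2 ↦ S₃)
  Part : (C4 → Set) → C4 → Fin 3 → C4 → Set
  Part K x Fin.zero y = K y × Conflict x y × Type1a x y
  Part K x (Fin.suc Fin.zero) y = K y × Conflict x y × Type1b x y
  Part K x (Fin.suc (Fin.suc Fin.zero)) y =
    SameC4 x y ⊎ (K y × Conflict x y × (Type2 x y ⊎ Type3 x y))

  ShareSimEdge : C4 → C4 → Set
  ShareSimEdge y z = Σ SimEdge λ e → HasSimEdge y e × HasSimEdge z e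

-- With m₂ = 1 every vertex of V₂ has a single S-neighbour, so a set of
-- similarity edges is a matching as soon as no two of its edges share a
-- V₁-endpoint. If two c₄s share a similarity edge and have at most one
-- V₁-vertex in common, their four similarity edges satisfy this, so the two
-- c₄s do not conflict. Any two c₄s taken from different sets among S₁, S₂,
-- S₃ are separated by a V₁-vertex of x lying in one but not in the other,
-- hence have at most one common V₁-vertex; as they conflict (through the
-- clique, or directly with x), they cannot share a similarity edge.
module Submission where

open import Defs
open import Data.Fin using (Fin)
open import Relation.Nullary using (¬_)
open import Relation.Binary.PropositionalEquality using (_≡_; _≢_)

open import Data.Nat using (_≤_; _<_)
open import Data.Nat.Properties using (<⇒≱)
open import Data.Bool using (Bool; true)
open import Data.Empty using (⊥-elim)
open import Function using (_∘′_)
open import Data.Fin using (zero; suc; _≟_)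
open import Data.Fin.Subset using (Subset; _∈_; ⁅_⁆; _⊂_; ∣_∣)
open import Data.Fin.Subset.Properties using (x∈⁅y⁆⇒x≡y; x≢y⇒x∉⁅y⁆; ∣⁅x⁆∣≡1; p⊂q⇒∣p∣<∣q∣)
open import Data.Product using (Σ; _×_; _,_; proj₁; proj₂)
open import Data.Product.Properties using (≡-dec)
open import Data.Sum using (_⊎_; inj₁; inj₂)
open import Data.Vec using (tabulate)
open import Data.Vec.Properties using (lookup⇒[]=; lookup∘tabulate)
open import Relation.Nullary using (Dec; yes; no; does; contradiction)
open import Relation.Nullary.Decidable using (dec-true; _⊎-dec_)
open import Relation.Binary.PropositionalEquality using (refl; sym; trans; cong₂; subst)
open import Relation.Unary using (Pred; Decidable)

∣p∣≤1⇒∈-unique : ∀ {n} {p : Subset n} {x y} → ∣ p ∣ ≤ 1 → x ∈ p → y ∈ p → x ≡ y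
∣p∣≤1⇒∈-unique {p = p} {x} {y} ∣p∣≤1 x∈p y∈p with x ≟ y
... | yes x≡y = x≡y
... | no x≢y =
  contradiction ∣p∣≤1 (<⇒≱ (subst (_< ∣ p ∣) (∣⁅x⁆∣≡1 x) (p⊂q⇒∣p∣<∣q∣ ⁅x⁆⊂p)))
  where
    ⁅x⁆⊂p : ⁅ x ⁆ ⊂ p
    ⁅x⁆⊂p = (λ z∈⁅x⁆ → subst (_∈ p) (sym (x∈⁅y⁆⇒x≡y x z∈⁅x⁆)) x∈p)
          , y , y∈p , x≢y⇒x∉⁅y⁆ (x≢y ∘′ sym)

∈-tabulate : ∀ {n} (f : Fin n → Bool) {x} → f x ≡ true → x ∈ tabulate f
∈-tabulate f {x} fx = lookup⇒[]= x (tabulate f) (trans (lookup∘tabulate f x) fx)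

does⇒witness : ∀ {A : Set} (A? : Dec A) → does A? ≡ true → A
does⇒witness (yes a) _ = a

module _ (I : CAI) where
  open CAI I

  a≢b : (y : C4 I) → a y ≢ b y
  a≢b y a≡b with trans (sym (subst (λ v → E₁ (a y) v ≡ true) (sym a≡b) (ab y))) (E₁-irrefl (a y))
  ... | ()

  HasSimEdge⇒S : (y : C4 I) {e : SimEdge I} → HasSimEdge I y e → S (proj₁ e) (proj₂ e) ≡ true
  HasSimEdge⇒S y (inj₁ refl) = ad y
  HasSimEdge⇒S y (inj₂ refl) = bc y

  HasSimEdge? : (y : C4 I) → Decidable (HasSimEdge I y)
  HasSimEdge? y e = ≡-dec _≟_ _≟_ e (a y , d y) ⊎-dec ≡-dec _≟_ _≟_ e (b y , c y)

  HasSimEdge⇒InV₁ : (y : C4 I) {e : SimEdge I} → HasSimEdge I y e → InV₁ I (proj₁ e) y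
  HasSimEdge⇒InV₁ y (inj₁ refl) = inj₁ refl
  HasSimEdge⇒InV₁ y (inj₂ refl) = inj₂ refl

  HasSimEdge-injective₁ : (y : C4 I) {e f : SimEdge I} → HasSimEdge I y e → HasSimEdge I y f
                        → proj₁ e ≡ proj₁ f → e ≡ f
  HasSimEdge-injective₁ y (inj₁ refl) (inj₁ refl) _   = refl
  HasSimEdge-injective₁ y (inj₁ refl) (inj₂ refl) a≡b = ⊥-elim (a≢b y a≡b)
  HasSimEdge-injective₁ y (inj₂ refl) (inj₁ refl) b≡a = ⊥-elim (a≢b y (sym b≡a))
  HasSimEdge-injective₁ y (inj₂ refl) (inj₂ refl) _   = refl

  InV₁-other-unique : ∀ {t w w'} (y : C4 I) → InV₁ I t y → InV₁ I w y → InV₁ I w' y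
                    → w ≢ t → w' ≢ t → w ≡ w'
  InV₁-other-unique y _           (inj₁ refl) (inj₁ refl) _   _   = refl
  InV₁-other-unique y _           (inj₂ refl) (inj₂ refl) _   _   = refl
  InV₁-other-unique y (inj₁ refl) (inj₁ refl) (inj₂ refl) w≢t _   = ⊥-elim (w≢t refl)
  InV₁-other-unique y (inj₂ refl) (inj₁ refl) (inj₂ refl) _   w≢t = ⊥-elim (w≢t refl)
  InV₁-other-unique y (inj₁ refl) (inj₂ refl) (inj₁ refl) _   w≢t = ⊥-elim (w≢t refl)
  InV₁-other-unique y (inj₂ refl) (inj₂ refl) (inj₁ refl) w≢t _   = ⊥-elim (w≢t refl)

  SameC4⇒InV₁ : ∀ {w} (y z : C4 I) → SameC4 I y z → InV₁ I w y → InV₁ I w z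
  SameC4⇒InV₁ y z (inj₁ (a≡ , b≡ , _)) (inj₁ w≡) = inj₁ (trans w≡ (sym a≡))
  SameC4⇒InV₁ y z (inj₁ (a≡ , b≡ , _)) (inj₂ w≡) = inj₂ (trans w≡ (sym b≡))
  SameC4⇒InV₁ y z (inj₂ (a≡ , b≡ , _)) (inj₁ w≡) = inj₂ (trans w≡ (sym b≡))
  SameC4⇒InV₁ y z (inj₂ (a≡ , b≡ , _)) (inj₂ w≡) = inj₁ (trans w≡ (sym a≡))

  SameC4⇒HasSimEdge : ∀ {e} (y z : C4 I) → SameC4 I y z → HasSimEdge I z e → HasSimEdge I y e
  SameC4⇒HasSimEdge y z (inj₁ (a≡ , b≡ , c≡ , d≡)) (inj₁ e≡) = inj₁ (trans e≡ (cong₂ _,_ a≡ d≡))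
  SameC4⇒HasSimEdge y z (inj₁ (a≡ , b≡ , c≡ , d≡)) (inj₂ e≡) = inj₂ (trans e≡ (cong₂ _,_ b≡ c≡))
  SameC4⇒HasSimEdge y z (inj₂ (a≡ , b≡ , c≡ , d≡)) (inj₁ e≡) = inj₂ (trans e≡ (cong₂ _,_ a≡ d≡))
  SameC4⇒HasSimEdge y z (inj₂ (a≡ , b≡ , c≡ , d≡)) (inj₂ e≡) = inj₁ (trans e≡ (cong₂ _,_ b≡ c≡))

  ShareSimEdge-sym : ∀ y z → ShareSimEdge I y z → ShareSimEdge I z y
  ShareSimEdge-sym _ _ (e , y∋e , z∋e) = e , z∋e , y∋e

  AtMostOneCommonV₁ : C4 I → C4 I → Set
  AtMostOneCommonV₁ y z = ∀ {w w'} → InV₁ I w y → InV₁ I w z → InV₁ I w' y → InV₁ I w' z → w ≡ w'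

  ∉⇒AtMostOneCommonV₁ : ∀ {t} (y z : C4 I) → InV₁ I t y → ¬ InV₁ I t z → AtMostOneCommonV₁ y z
  ∉⇒AtMostOneCommonV₁ y z t∈y t∉z w∈y w∈z w'∈y w'∈z =
    InV₁-other-unique y t∈y w∈y w'∈y (λ { refl → t∉z w∈z }) (λ { refl → t∉z w'∈z })

  Matchable : C4 I → C4 I → Set
  Matchable y z = Σ (Fin n₁ → Fin n₂ → Bool) λ M → IsMatching I M
    × (∀ e → HasSimEdge I y e ⊎ HasSimEdge I z e → M (proj₁ e) (proj₂ e) ≡ true)

  module _ (m₂≡1 : m₂ ≡ 1) where

    S-injective₁ : ∀ {u u' v} → S u v ≡ true → S u' v ≡ true → u ≡ u'
    S-injective₁ {v = v} Suv Su'v =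
      ∣p∣≤1⇒∈-unique (subst (_ ≤_) m₂≡1 (deg₂ v))
        (∈-tabulate (λ u → S u v) Suv) (∈-tabulate (λ u → S u v) Su'v)

    injective₁⇒IsMatching : {P : Pred (SimEdge I) _} (P? : Decidable P)
      → (∀ {e} → P e → S (proj₁ e) (proj₂ e) ≡ true)
      → (∀ {e f} → P e → P f → proj₁ e ≡ proj₁ f → e ≡ f)
      → IsMatching I (λ u v → does (P? (u , v)))
    injective₁⇒IsMatching P? P⊆S injective₁ =
      (λ u v Muv → P⊆S (does⇒witness (P? (u , v)) Muv)) , disjoint
      where
        disjoint : ∀ e f → does (P? e) ≡ true → does (P? f) ≡ true → e ≢ f
                 → proj₁ e ≢ proj₁ f × proj₂ e ≢ proj₂ f
        disjoint e@(e₁ , e₂) f@(f₁ , f₂) Me Mf e≢f =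
          (λ e₁≡f₁ → e≢f (injective₁ Pe Pf e₁≡f₁))
          , λ { refl → e≢f (injective₁ Pe Pf (S-injective₁ (P⊆S Pe) (P⊆S Pf))) }
          where
            Pe = does⇒witness (P? e) Me
            Pf = does⇒witness (P? f) Mf

    ShareSimEdge⇒Matchable : ∀ y z → ShareSimEdge I y z → AtMostOneCommonV₁ y z → Matchable y z
    ShareSimEdge⇒Matchable y z (s , y∋s , z∋s) atMostOne =
      (λ u v → does (P? (u , v)))
      , injective₁⇒IsMatching P? P⊆S injective₁
      , λ e Pe → dec-true (P? e) Pe
      where
        P : Pred (SimEdge I) _
        P e = HasSimEdge I y e ⊎ HasSimEdge I z e
        P? : Decidable P
        P? e = HasSimEdge? y e ⊎-dec HasSimEdge? z e
        P⊆S : ∀ {e} → P e → S (proj₁ e) (proj₂ e) ≡ true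
        P⊆S (inj₁ y∋e) = HasSimEdge⇒S y y∋e
        P⊆S (inj₂ z∋e) = HasSimEdge⇒S z z∋e
        -- edges of y and z at a common V₁-vertex both equal the shared edge s
        across : ∀ {e f} → HasSimEdge I y e → HasSimEdge I z f → proj₁ e ≡ proj₁ f → e ≡ f
        across y∋e z∋f e₁≡f₁ =
          let e₁≡s₁ = atMostOne (HasSimEdge⇒InV₁ y y∋e)
                        (subst (λ w → InV₁ I w z) (sym e₁≡f₁) (HasSimEdge⇒InV₁ z z∋f))
                        (HasSimEdge⇒InV₁ y y∋s) (HasSimEdge⇒InV₁ z z∋s)
          in trans (HasSimEdge-injective₁ y y∋e y∋s e₁≡s₁)
                   (sym (HasSimEdge-injective₁ z z∋f z∋s (trans (sym e₁≡f₁) e₁≡s₁)))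
        injective₁ : ∀ {e f} → P e → P f → proj₁ e ≡ proj₁ f → e ≡ f
        injective₁ (inj₁ y∋e) (inj₁ y∋f) = HasSimEdge-injective₁ y y∋e y∋f
        injective₁ (inj₂ z∋e) (inj₂ z∋f) = HasSimEdge-injective₁ z z∋e z∋f
        injective₁ (inj₁ y∋e) (inj₂ z∋f) = across y∋e z∋f
        injective₁ (inj₂ z∋e) (inj₁ y∋f) e₁≡f₁ = sym (across y∋f z∋e (sym e₁≡f₁))

    Conflict⇒¬ShareSimEdge : ∀ {t} y z → Conflict I y z → InV₁ I t y → ¬ InV₁ I t z
                           → ¬ ShareSimEdge I y z
    Conflict⇒¬ShareSimEdge y z (_ , ¬matchable) t∈y t∉z share =
      ¬matchable (ShareSimEdge⇒Matchable y z share (∉⇒AtMostOneCommonV₁ y z t∈y t∉z))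

    module _ {K : C4 I → Set} (clique : IsClique I K) (x : C4 I) where

      clique⇒¬ShareSimEdge : ∀ {t} y z → K y → K z → InV₁ I t y → ¬ InV₁ I t z
                           → ¬ ShareSimEdge I y z
      clique⇒¬ShareSimEdge y z Ky Kz t∈y t∉z =
        Conflict⇒¬ShareSimEdge y z (clique y z Ky Kz (λ y≈z → t∉z (SameC4⇒InV₁ y z y≈z t∈y))) t∈y t∉z

      Type23⇒InV₁ : ∀ {t} z → Type2 I x z ⊎ Type3 I x z → InV₁ I t x → InV₁ I t z
      Type23⇒InV₁ _ (inj₁ (a∈z , _)) (inj₁ refl) = a∈z
      Type23⇒InV₁ _ (inj₁ (_ , b∈z , _)) (inj₂ refl) = b∈z
      Type23⇒InV₁ _ (inj₂ (a∈z , _)) (inj₁ refl) = a∈z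
      Type23⇒InV₁ _ (inj₂ (_ , b∈z , _)) (inj₂ refl) = b∈z

      Part₃-apart : ∀ {t} y z → K y → Conflict I x y → InV₁ I t x → ¬ InV₁ I t y
                  → Part I K x (suc (suc zero)) z → ¬ ShareSimEdge I y z
      Part₃-apart y z _ x⊥y t∈x t∉y (inj₁ x≈z) (e , y∋e , z∋e) =
        Conflict⇒¬ShareSimEdge x y x⊥y t∈x t∉y (e , SameC4⇒HasSimEdge x z x≈z z∋e , y∋e)
      Part₃-apart y z Ky _ t∈x t∉y (inj₂ (Kz , _ , type23)) share =
        clique⇒¬ShareSimEdge z y Kz Ky (Type23⇒InV₁ z type23 t∈x) t∉y (ShareSimEdge-sym y z share)

      Part₁-Part₂-apart : ∀ {y z} → Part I K x zero y → Part I K x (suc zero) z → ¬ ShareSimEdge I y z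
      Part₁-Part₂-apart {y} {z} (Ky , _ , a∈y , _) (Kz , _ , _ , a∉z) =
        clique⇒¬ShareSimEdge y z Ky Kz a∈y a∉z

      Part₁-Part₃-apart : ∀ {y z} → Part I K x zero y → Part I K x (suc (suc zero)) z → ¬ ShareSimEdge I y z
      Part₁-Part₃-apart {y} {z} (Ky , x⊥y , _ , b∉y) = Part₃-apart y z Ky x⊥y (inj₂ refl) b∉y

      Part₂-Part₃-apart : ∀ {y z} → Part I K x (suc zero) y → Part I K x (suc (suc zero)) z → ¬ ShareSimEdge I y z
      Part₂-Part₃-apart {y} {z} (Ky , x⊥y , _ , a∉y) = Part₃-apart y z Ky x⊥y (inj₁ refl) a∉y

      Part-apart : ∀ {i j} → i ≢ j → ∀ {y z} → Part I K x i y → Part I K x j z → ¬ ShareSimEdge I y z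
      Part-apart {zero}           {suc zero}       _ = Part₁-Part₂-apart
      Part-apart {zero}           {suc (suc zero)} _ = Part₁-Part₃-apart
      Part-apart {suc zero}       {suc (suc zero)} _ = Part₂-Part₃-apart
      Part-apart {suc zero}       {zero}           _ {y} {z} y∈ z∈ = Part₁-Part₂-apart z∈ y∈ ∘′ ShareSimEdge-sym y z
      Part-apart {suc (suc zero)} {zero}           _ {y} {z} y∈ z∈ = Part₁-Part₃-apart z∈ y∈ ∘′ ShareSimEdge-sym y z
      Part-apart {suc (suc zero)} {suc zero}       _ {y} {z} y∈ z∈ = Part₂-Part₃-apart z∈ y∈ ∘′ ShareSimEdge-sym y z
      Part-apart {zero}           {zero}           i≢i _ _ = ⊥-elim (i≢i refl)
      Part-apart {suc zero}       {suc zero}       i≢i _ _ = ⊥-elim (i≢i refl)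
      Part-apart {suc (suc zero)} {suc (suc zero)} i≢i _ _ = ⊥-elim (i≢i refl)

lemma11 : (I : CAI) → CAI.m₂ I ≡ 1
    → (K : C4 I → Set) → IsClique I K
    → (x : C4 I) → K x
    → (i j : Fin 3) → i ≢ j
    → (y z : C4 I) → Part I K x i y → Part I K x j z
    → ¬ ShareSimEdge I y z
lemma11 I m₂≡1 K clique x _ _ _ i≢j _ _ = Part-apart I m₂≡1 clique x i≢j
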